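{- Let $m_1, l_2, m_2$ be positive integers with $m_1 < l_2 \le m_2$, and let $k$ be a positive integer. Let \[ g(m_1,l_2,m_2) = \#\{X \subseteq [1,m_1]\cup[l_2,m_2] :\ l_2 \in X \text{ and } \gcd(X) = 1\}, \] \[ g_k(m_1,l_2,m_2) = \#\{X \subseteq [1,m_1]\cup[l_2,m_2] :\ l_2 \in X,\ \#X = k, \text{ and } \gcd(X) = 1\}. \] Then (a) $\displaystyle g(m_1,l_2,m_2) = \sum_{d \mid l_2} \mu(d)\, 2^{\lfloor m_1/d\rfloor + \lfloor m_2/d\rfloor - l_2/d}$; (b) $\displaystyle g_k(m_1,l_2,m_2) = \sum_{d \mid l_2} \mu(d) \binom{\lfloor m_1/d\rfloor + \lfloor m_2/d\rfloor - l_2/d}{k-1}$.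
   Context: For positive integers $l \le m$, $[l,m] = \{l, l+1, \ldots, m\}$. $\mu$ is the Möbius function, $\lfloor x\rfloor$ is the floor of $x$, and $\gcd(X)$ is the greatest common divisor of the elements of a nonempty finite set $X$ of positive integers. The sums are over positive divisors $d$ of $l_2$. -}

module Defs where

open import Data.Nat using (ℕ; zero; suc; _+_; _*_; _∸_; _^_; _≤_; _<_)
open import Data.Nat.Divisibility using (_∣_; _∣?_)
open import Data.Nat.DivMod using (_/_)
open import Data.Nat.GCD using (gcd)
open import Data.Nat.Primality using (Prime; prime?)
open import Data.Nat.Combinatorics using (_C_)
open import Data.Nat.Properties using (_≟_)
open import Data.Integer as ℤ using (ℤ; +_)
open import Data.List using (List; []; _∷_; _++_; map; length; filter; applyUpTo; foldr; sum)
open import Data.List.Membership.Propositional using (_∈_)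
open import Data.List.Membership.DecPropositional _≟_ using (_∈?_)
open import Data.Product using (_×_)
open import Relation.Nullary.Decidable using (_×-dec_; ⌊_⌋)
open import Data.Bool.ListAction using (any)
open import Data.Bool using (Bool; true; false; if_then_else_; not)

interval : ℕ → ℕ → List ℕ
interval a b = applyUpTo (λ i → a + i) (suc b ∸ a)

-- all sub-lists (subsequences) of a list; for a duplicate-free list these
-- are in bijection with the subsets of its underlying set
sublists : List ℕ → List (List ℕ)
sublists []       = [] ∷ []
sublists (x ∷ xs) = map (x ∷_) (sublists xs) ++ sublists xs

ground : ℕ → ℕ → ℕ → List ℕ
ground m1 l2 m2 = interval 1 m1 ++ interval l2 m2

gcdList : List ℕ → ℕ
gcdList = foldr gcd 0

g : ℕ → ℕ → ℕ → ℕ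
g m1 l2 m2 = length (filter (λ X → (l2 ∈? X) ×-dec (gcdList X ≟ 1)) (sublists (ground m1 l2 m2)))

gk : ℕ → ℕ → ℕ → ℕ → ℕ
gk k m1 l2 m2 = length (filter (λ X → (l2 ∈? X) ×-dec ((length X ≟ k) ×-dec (gcdList X ≟ 1)))
                               (sublists (ground m1 l2 m2)))

squarefree : ℕ → Bool
squarefree d = not (any (λ p → ⌊ (p * p) ∣? d ⌋) (interval 2 d))

numPrimeDivisors : ℕ → ℕ
numPrimeDivisors d = length (filter (λ p → prime? p ×-dec (p ∣? d)) (interval 1 d))

μ : ℕ → ℤ
μ d = if squarefree d then (ℤ.-1ℤ ℤ.^ numPrimeDivisors d) else ℤ.0ℤ

-- sum over positive divisors d of n of f d  (f receives d = suc e so that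
-- division by d is available)
divisorSum : ℕ → (ℕ → ℤ) → ℤ
divisorSum n f = foldr ℤ._+_ ℤ.0ℤ (map (λ d → if ⌊ d ∣? n ⌋ then f d else ℤ.0ℤ) (interval 1 n))

-- exponent ⌊m1/d⌋ + ⌊m2/d⌋ - l2/d  (d ≥ 1; d = 0 never occurs in the sums)
expo : ℕ → ℕ → ℕ → ℕ → ℕ
expo m1 l2 m2 zero    = 0
expo m1 l2 m2 (suc e) = (m1 / suc e) + (m2 / suc e) ∸ (l2 / suc e)

rhsA : ℕ → ℕ → ℕ → ℤ
rhsA m1 l2 m2 = divisorSum l2 (λ d → μ d ℤ.* (+ (2 ^ expo m1 l2 m2 d)))

rhsB : ℕ → ℕ → ℕ → ℕ → ℤ
rhsB k m1 l2 m2 = divisorSum l2 (λ d → μ d ℤ.* (+ (expo m1 l2 m2 d C (k ∸ 1))))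

{-# OPTIONS --safe #-}
module Submission where

-- Möbius inversion writes [gcd X = 1] as Σ_{d ∣ gcd X} μ(d), and since l2 ∈ X every such d divides l2,
-- so g = Σ_{d ∣ l2} μ(d) N_d where N_d counts the sets X ∋ l2 of multiples of d (likewise for g_k).
-- The ground set contains ⌊m1/d⌋ + ⌊m2/d⌋ − ⌊(l2 − 1)/d⌋ = e + 1 multiples of d, with e the exponent
-- ⌊m1/d⌋ + ⌊m2/d⌋ − l2/d, and l2 is one of them. Counting all sets of such multiples and subtracting
-- those avoiding l2 gives N_d = 2^(e+1) − 2^e = 2^e, and C(e+1, k) − C(e, k) = C(e, k − 1) for size k.
-- The identity Σ_{d ∣ c} μ(d) = [c = 1] follows by splitting the divisors of c = c′p (p prime) according
-- to whether p divides them, since μ(pe) = −μ(e) if p ∤ e and μ(pe) = 0 otherwise.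

open import Defs
open import Data.Nat using (ℕ; _≤_; _<_)
open import Data.Integer using (+_)
open import Data.Product using (_×_)
open import Relation.Binary.PropositionalEquality using (_≡_)

open import Data.Bool using (Bool; true; false; if_then_else_; not; _∧_; _∨_)
open import Data.Bool.ListAction using (any; all)
open import Data.Bool.Properties using (T-≡; not-injective; ∧-zeroʳ)
open import Data.Integer as ℤ using (ℤ; 0ℤ; 1ℤ; _+_; _-_; _*_; -_)
import Data.Integer.Properties as ℤ
open import Data.Integer.Tactic.RingSolver using (solve-∀)
open import Data.List using (List; []; _∷_; _++_; map; foldr; applyUpTo; length; filter; [_]; _∷ʳ_)
open import Data.List.Properties using (applyUpTo-∷ʳ; length-applyUpTo)
open import Data.List.Membership.Propositional using (_∈_; find; lose)
open import Data.List.Membership.Propositional.Properties using (∈-applyUpTo⁺; ∈-applyUpTo⁻)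
open import Data.List.Relation.Unary.All using (_∷_)
open import Data.List.Relation.Unary.Any using (here; there)
open import Data.List.Relation.Unary.Any.Properties using (any⁺; any⁻)
open import Data.Nat as ℕ using (zero; suc; _∸_; _^_; NonZero; z≤n; s≤s)
import Data.Nat.Properties as ℕ
open import Data.List.Membership.DecPropositional ℕ._≟_ using (_∈?_)
open import Data.Nat.Combinatorics using (_C_; nCk+nC[k+1]≡[n+1]C[k+1])
open import Data.Nat.Coprimality using (Coprime; coprime-divisor)
import Data.Nat.Coprimality as Coprime
open import Data.Nat.Divisibility
  using (_∣_; _∣?_; _∣0; divides; m∣m*n; ∣m⇒∣m*n; ∣n⇒∣m*n; ∣-trans; ∣⇒≤; *-pres-∣; *-monoʳ-∣; *-cancelˡ-∣)
open import Data.Nat.DivMod using (_/_; m≡m%n+[m/n]*n; m%n<n; m/n*n≤m; /-monoˡ-≤)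
open import Data.Nat.GCD using (gcd; gcd[m,n]∣m; gcd[m,n]∣n; gcd-greatest)
open import Data.Nat.Primality
  using (Prime; prime?; euclidsLemma; prime⇒irreducible; ¬prime[1]; prime⇒nonZero; prime⇒nonTrivial)
open import Data.Nat.Primality.Factorisation using (factorise)
open import Data.Product using (_,_; ∃-syntax; proj₁)
open import Data.Sum using (inj₁; inj₂; reduce)
open import Function using (_∘_; it)
open import Function.Bundles using (Equivalence)
open import Relation.Binary.Definitions using (Tri; tri<; tri≈; tri>)
open import Relation.Binary.PropositionalEquality using (refl; sym; trans; cong; cong₂; subst; module ≡-Reasoning)
open import Relation.Nullary using (Dec; yes; no; does; ¬_; contradiction)
open import Relation.Nullary.Decidable using (dec-true; dec-false; toWitness; fromWitness; ⌊_⌋; _×-dec_)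
open import Relation.Unary using (Decidable)

-- Sums over lists

𝟙 : Bool → ℤ
𝟙 b = if b then 1ℤ else 0ℤ

∑ : {A : Set} → (A → ℤ) → List A → ℤ
∑ f xs = foldr _+_ 0ℤ (map f xs)

syntax ∑ (λ x → e) xs = ∑[ x ∈ xs ] e

private
  variable
    A B : Set

∑-++ : (f : A → ℤ) (xs ys : List A) → ∑ f (xs ++ ys) ≡ ∑ f xs + ∑ f ys
∑-++ f []       ys = sym (ℤ.+-identityˡ _)
∑-++ f (x ∷ xs) ys = trans (cong (_+_ (f x)) (∑-++ f xs ys)) (sym (ℤ.+-assoc (f x) _ _))

∑-map : (f : B → ℤ) (g : A → B) (xs : List A) → ∑ f (map g xs) ≡ ∑ (f ∘ g) xs
∑-map f g []       = refl
∑-map f g (x ∷ xs) = cong (_+_ (f (g x))) (∑-map f g xs)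

∑-cong-∈ : {f g : A → ℤ} (xs : List A) → (∀ {x} → x ∈ xs → f x ≡ g x) → ∑ f xs ≡ ∑ g xs
∑-cong-∈ []       eq = refl
∑-cong-∈ (x ∷ xs) eq = cong₂ _+_ (eq (here refl)) (∑-cong-∈ xs (eq ∘ there))

∑-cong : {f g : A → ℤ} (xs : List A) → (∀ x → f x ≡ g x) → ∑ f xs ≡ ∑ g xs
∑-cong xs eq = ∑-cong-∈ xs (λ {x} _ → eq x)

∑-zero : {f : A → ℤ} (xs : List A) → (∀ {x} → x ∈ xs → f x ≡ 0ℤ) → ∑ f xs ≡ 0ℤ
∑-zero []       eq = refl
∑-zero (x ∷ xs) eq = cong₂ _+_ (eq (here refl)) (∑-zero xs (eq ∘ there))

∑-+ : (f g : A → ℤ) (xs : List A) → ∑[ x ∈ xs ] (f x + g x) ≡ ∑ f xs + ∑ g xs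
∑-+ f g []       = refl
∑-+ f g (x ∷ xs) = trans (cong (_+_ (f x + g x)) (∑-+ f g xs)) (shuffle (f x) (g x) _ _)
  where
  shuffle : ∀ a b c d → a + b + (c + d) ≡ a + c + (b + d)
  shuffle = solve-∀

∑-neg : (f : A → ℤ) (xs : List A) → ∑[ x ∈ xs ] (- f x) ≡ - ∑ f xs
∑-neg f []       = refl
∑-neg f (x ∷ xs) = trans (cong (_+_ (- f x)) (∑-neg f xs)) (sym (ℤ.neg-distrib-+ (f x) _))

∑-- : (f g : A → ℤ) (xs : List A) → ∑[ x ∈ xs ] (f x - g x) ≡ ∑ f xs - ∑ g xs
∑-- f g xs = trans (∑-+ f (-_ ∘ g) xs) (cong (_+_ (∑ f xs)) (∑-neg g xs))

∑-*ˡ : (c : ℤ) (f : A → ℤ) (xs : List A) → ∑[ x ∈ xs ] (c * f x) ≡ c * ∑ f xs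
∑-*ˡ c f []       = sym (ℤ.*-zeroʳ c)
∑-*ˡ c f (x ∷ xs) = trans (cong (_+_ (c * f x)) (∑-*ˡ c f xs)) (sym (ℤ.*-distribˡ-+ c (f x) _))

∑-comm : (F : A → B → ℤ) (xs : List A) (ys : List B) →
         ∑[ x ∈ xs ] ∑[ y ∈ ys ] F x y ≡ ∑[ y ∈ ys ] ∑[ x ∈ xs ] F x y
∑-comm F []       ys = sym (∑-zero ys (λ _ → refl))
∑-comm F (x ∷ xs) ys =
  trans (cong (_+_ (∑ (F x) ys)) (∑-comm F xs ys)) (sym (∑-+ (F x) (λ y → ∑[ x ∈ xs ] F x y) ys))

∑-1 : (xs : List A) → ∑ (λ _ → 1ℤ) xs ≡ + length xs
∑-1 []       = refl
∑-1 (x ∷ xs) = cong (_+_ 1ℤ) (∑-1 xs)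

length-filter-∑ : {P : A → Set} (P? : Decidable P) (xs : List A) →
                  + length (filter P? xs) ≡ ∑[ x ∈ xs ] 𝟙 (does (P? x))
length-filter-∑ P? []       = refl
length-filter-∑ P? (x ∷ xs) with does (P? x)
... | true  = cong (_+_ 1ℤ) (length-filter-∑ P? xs)
... | false = trans (length-filter-∑ P? xs) (sym (ℤ.+-identityˡ _))

-- Sums over intervals

applyUpTo-++ : (f : ℕ → A) (m k : ℕ) →
               applyUpTo f m ++ applyUpTo (λ i → f (m ℕ.+ i)) k ≡ applyUpTo f (m ℕ.+ k)
applyUpTo-++ f zero    k = refl
applyUpTo-++ f (suc m) k = cong (f 0 ∷_) (applyUpTo-++ (f ∘ suc) m k)

∈-interval⁺ : ∀ {a b x} → a ≤ x → x ≤ b → x ∈ interval a b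
∈-interval⁺ {a} {b} {x} a≤x x≤b =
  subst (_∈ interval a b) (ℕ.m+[n∸m]≡n a≤x) (∈-applyUpTo⁺ (a ℕ.+_) (ℕ.∸-monoˡ-< (s≤s x≤b) a≤x))

∈-interval⁻ : ∀ {a b x} → x ∈ interval a b → a ≤ x × x ≤ b
∈-interval⁻ {a} {b} x∈ with ∈-applyUpTo⁻ (a ℕ.+_) x∈
... | i , i<len , refl = ℕ.m≤m+n a i , a+i≤b
  where
  a≤1+b : a ≤ suc b
  a≤1+b = ℕ.<⇒≤ (ℕ.m∸n≢0⇒n<m (λ len≡0 → ℕ.n≮0 (subst (i <_) len≡0 i<len)))
  a+i≤b : a ℕ.+ i ≤ b
  a+i≤b = ℕ.≤-pred (subst (_≤ suc b) (cong suc (ℕ.+-comm i a)) (ℕ.m≤o∸n⇒m+n≤o (suc i) a≤1+b i<len))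

interval-++ : ∀ {m n} → m ≤ n → interval 1 m ++ interval (suc m) n ≡ interval 1 n
interval-++ {m} {n} m≤n = trans (applyUpTo-++ suc m (n ∸ m)) (cong (applyUpTo suc) (ℕ.m+[n∸m]≡n m≤n))

∑-interval-++ : ∀ (f : ℕ → ℤ) {m n} → m ≤ n →
                ∑ f (interval 1 n) ≡ ∑ f (interval 1 m) + ∑ f (interval (suc m) n)
∑-interval-++ f {m} m≤n = trans (cong (∑ f) (sym (interval-++ m≤n))) (∑-++ f (interval 1 m) _)

∑-interval-∷ʳ : ∀ (f : ℕ → ℤ) n → ∑ f (interval 1 (suc n)) ≡ ∑ f (interval 1 n) + f (suc n)
∑-interval-∷ʳ f n = begin
  ∑ f (interval 1 (suc n))            ≡⟨ cong (∑ f) (applyUpTo-∷ʳ suc n) ⟨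
  ∑ f (interval 1 n ∷ʳ suc n)         ≡⟨ ∑-++ f (interval 1 n) [ suc n ] ⟩
  ∑ f (interval 1 n) + (f (suc n) + 0ℤ) ≡⟨ cong (_+_ (∑ f (interval 1 n))) (ℤ.+-identityʳ _) ⟩
  ∑ f (interval 1 n) + f (suc n)      ∎
  where open ≡-Reasoning

∑-interval-truncate : ∀ (f : ℕ → ℤ) {m n} → m ≤ n → (∀ {x} → m < x → x ≤ n → f x ≡ 0ℤ) →
                      ∑ f (interval 1 n) ≡ ∑ f (interval 1 m)
∑-interval-truncate f {m} {n} m≤n vanish = begin
  ∑ f (interval 1 n)                                ≡⟨ ∑-interval-++ f m≤n ⟩
  ∑ f (interval 1 m) + ∑ f (interval (suc m) n)     ≡⟨ cong (_+_ (∑ f (interval 1 m))) tail≡0 ⟩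
  ∑ f (interval 1 m) + 0ℤ                           ≡⟨ ℤ.+-identityʳ _ ⟩
  ∑ f (interval 1 m)                                ∎
  where
  open ≡-Reasoning
  tail≡0 : ∑ f (interval (suc m) n) ≡ 0ℤ
  tail≡0 = ∑-zero (interval (suc m) n) (λ x∈ → let m<x , x≤n = ∈-interval⁻ x∈ in vanish m<x x≤n)

∤-between-multiples : ∀ {p q x} .{{_ : NonZero p}} → q ℕ.* p < x → x < suc q ℕ.* p → ¬ p ∣ x
∤-between-multiples {p} {q} qp<x x<[1+q]p (divides r refl) =
  ℕ.<⇒≱ (ℕ.*-cancelʳ-< p q r qp<x) (ℕ.≤-pred (ℕ.*-cancelʳ-< p r (suc q) x<[1+q]p))

∑-multiples : ∀ p .{{_ : NonZero p}} (f : ℕ → ℤ) q →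
              ∑[ x ∈ interval 1 (q ℕ.* p) ] (if does (p ∣? x) then f x else 0ℤ) ≡ ∑[ e ∈ interval 1 q ] f (p ℕ.* e)
∑-multiples p           f zero    = refl
∑-multiples p@(suc p-1) f (suc q) = begin
  ∑ h (interval 1 (suc q ℕ.* p))                     ≡⟨ cong (λ n → ∑ h (interval 1 n)) [1+q]p≡1+qp+p-1 ⟩
  ∑ h (interval 1 (suc (q ℕ.* p ℕ.+ p-1)))          ≡⟨ ∑-interval-∷ʳ h (q ℕ.* p ℕ.+ p-1) ⟩
  ∑ h (interval 1 (q ℕ.* p ℕ.+ p-1)) + h (suc (q ℕ.* p ℕ.+ p-1))
    ≡⟨ cong₂ _+_ (∑-interval-truncate h (ℕ.m≤m+n _ p-1) vanish) last ⟩
  ∑ h (interval 1 (q ℕ.* p)) + f (p ℕ.* suc q)      ≡⟨ cong (_+ f (p ℕ.* suc q)) (∑-multiples p f q) ⟩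
  ∑[ e ∈ interval 1 q ] f (p ℕ.* e) + f (p ℕ.* suc q) ≡⟨ ∑-interval-∷ʳ (λ e → f (p ℕ.* e)) q ⟨
  ∑[ e ∈ interval 1 (suc q) ] f (p ℕ.* e)           ∎
  where
  open ≡-Reasoning
  h : ℕ → ℤ
  h x = if does (p ∣? x) then f x else 0ℤ
  [1+q]p≡1+qp+p-1 : suc q ℕ.* p ≡ suc (q ℕ.* p ℕ.+ p-1)
  [1+q]p≡1+qp+p-1 = trans (ℕ.+-comm p (q ℕ.* p)) (ℕ.+-suc (q ℕ.* p) p-1)
  vanish : ∀ {x} → q ℕ.* p < x → x ≤ q ℕ.* p ℕ.+ p-1 → h x ≡ 0ℤ
  vanish {x} qp<x x≤ = cong (if_then f x else 0ℤ) (dec-false (p ∣? x)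
    (∤-between-multiples {q = q} qp<x (subst (x <_) (sym [1+q]p≡1+qp+p-1) (s≤s x≤))))
  last : h (suc (q ℕ.* p ℕ.+ p-1)) ≡ f (p ℕ.* suc q)
  last = trans (cong h (trans (sym [1+q]p≡1+qp+p-1) (ℕ.*-comm (suc q) p)))
               (cong (if_then f (p ℕ.* suc q) else 0ℤ) (dec-true (p ∣? (p ℕ.* suc q)) (m∣m*n (suc q))))

∑-interval-divisible : ∀ d .{{_ : NonZero d}} N → ∑[ x ∈ interval 1 N ] 𝟙 (does (d ∣? x)) ≡ + (N / d)
∑-interval-divisible d N = begin
  ∑ χ (interval 1 N)                   ≡⟨ ∑-interval-truncate χ (m/n*n≤m N d) vanish ⟩
  ∑ χ (interval 1 (N / d ℕ.* d))       ≡⟨ ∑-multiples d (λ _ → 1ℤ) (N / d) ⟩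
  ∑ (λ _ → 1ℤ) (interval 1 (N / d))    ≡⟨ ∑-1 (interval 1 (N / d)) ⟩
  + length (interval 1 (N / d))        ≡⟨ cong +_ (length-applyUpTo suc (N / d)) ⟩
  + (N / d)                            ∎
  where
  open ≡-Reasoning
  χ : ℕ → ℤ
  χ x = 𝟙 (does (d ∣? x))
  N<[1+N/d]d : N < suc (N / d) ℕ.* d
  N<[1+N/d]d = subst (_< suc (N / d) ℕ.* d) (sym (m≡m%n+[m/n]*n N d)) (ℕ.+-monoˡ-< (N / d ℕ.* d) (m%n<n N d))
  vanish : ∀ {x} → N / d ℕ.* d < x → x ≤ N → χ x ≡ 0ℤ
  vanish {x} lo x≤N = cong 𝟙 (dec-false (d ∣? x) (∤-between-multiples {q = N / d} lo (ℕ.≤-<-trans x≤N N<[1+N/d]d)))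

∑-interval-equal : ∀ {a} N → 1 ≤ a → ∑[ x ∈ interval 1 N ] 𝟙 (does (a ℕ.≟ x)) ≡ 𝟙 (does (a ℕ.≤? N))
∑-interval-equal {suc a} zero    _   = refl
∑-interval-equal {a}     (suc N) 1≤a = begin
  ∑[ x ∈ interval 1 (suc N) ] 𝟙 (does (a ℕ.≟ x))                ≡⟨ ∑-interval-∷ʳ _ N ⟩
  ∑[ x ∈ interval 1 N ] 𝟙 (does (a ℕ.≟ x)) + 𝟙 (does (a ℕ.≟ suc N)) ≡⟨ cong (_+ 𝟙 (does (a ℕ.≟ suc N))) (∑-interval-equal N 1≤a) ⟩
  𝟙 (does (a ℕ.≤? N)) + 𝟙 (does (a ℕ.≟ suc N))                   ≡⟨ step (ℕ.<-cmp a (suc N)) ⟩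
  𝟙 (does (a ℕ.≤? suc N))                                       ∎
  where
  open ≡-Reasoning
  step : Tri (a < suc N) (a ≡ suc N) (a ℕ.> suc N) → 𝟙 (does (a ℕ.≤? N)) + 𝟙 (does (a ℕ.≟ suc N)) ≡ 𝟙 (does (a ℕ.≤? suc N))
  step (tri< a<1+N a≢1+N _) rewrite dec-true (a ℕ.≤? N) (ℕ.≤-pred a<1+N) | dec-false (a ℕ.≟ suc N) a≢1+N
                                  | dec-true (a ℕ.≤? suc N) (ℕ.<⇒≤ a<1+N) = refl
  step (tri≈ _ refl _)          rewrite dec-false (suc N ℕ.≤? N) ℕ.1+n≰n | dec-true (suc N ℕ.≟ suc N) refl
                                  | dec-true (suc N ℕ.≤? suc N) ℕ.≤-refl = refl
  step (tri> _ a≢1+N 1+N<a)     rewrite dec-false (a ℕ.≤? N) (ℕ.<⇒≱ (ℕ.<-trans (ℕ.n<1+n N) 1+N<a)) | dec-false (a ℕ.≟ suc N) a≢1+N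
                                  | dec-false (a ℕ.≤? suc N) (ℕ.<⇒≱ 1+N<a) = refl

-- The Möbius function

∃-prime-divisor : ∀ {n} → 2 ≤ n → ∃[ p ] Prime p × p ∣ n
∃-prime-divisor {1}                (s≤s ())
∃-prime-divisor {n@(suc (suc _))} _ with factorise n
... | record { factors = p ∷ ps ; isFactorisation = n≡p*ps ; factorsPrime = pp ∷ _ } =
  p , pp , subst (p ∣_) (sym n≡p*ps) (m∣m*n _)

prime-∣-prime : ∀ {q p} → Prime q → Prime p → q ∣ p → q ≡ p
prime-∣-prime pq pp q∣p with prime⇒irreducible pp q∣p
... | inj₁ refl = contradiction pq ¬prime[1]
... | inj₂ q≡p  = q≡p

prime-∤⇒coprime : ∀ {p n} → Prime p → ¬ p ∣ n → Coprime p n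
prime-∤⇒coprime pp p∤n (d∣p , d∣n) with prime⇒irreducible pp d∣p
... | inj₁ d≡1 = d≡1
... | inj₂ refl = contradiction d∣n p∤n

square-∣-*-prime : ∀ {p r e} → Prime p → Prime r → ¬ p ∣ e → r ℕ.* r ∣ p ℕ.* e → r ℕ.* r ∣ e
square-∣-*-prime {p} {r} {e} pp pr p∤e r²∣pe = coprime-divisor (Coprime.sym (prime-∤⇒coprime pp p∤r²)) r²∣pe
  where
  instance
    p≢0 : NonZero p
    p≢0 = prime⇒nonZero pp
  p∤r² : ¬ p ∣ r ℕ.* r
  p∤r² p∣r² with refl ← prime-∣-prime pp pr (reduce (euclidsLemma r r pp p∣r²)) = p∤e (*-cancelˡ-∣ p r²∣pe)

squareful⇒¬squarefree : ∀ {n p} .{{_ : NonZero n}} → Prime p → p ℕ.* p ∣ n → squarefree n ≡ false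
squareful⇒¬squarefree {n} {p} pp p²∣n =
  cong not (Equivalence.to T-≡ (any⁺ _ (lose p∈[2,n] (fromWitness p²∣n))))
  where
  instance
    p≢0 : NonZero p
    p≢0 = prime⇒nonZero pp
  p∈[2,n] : p ∈ interval 2 n
  p∈[2,n] = ∈-interval⁺ (ℕ.nonTrivial⇒n>1 p {{prime⇒nonTrivial pp}}) (ℕ.≤-trans (ℕ.m≤m*n p p) (∣⇒≤ p²∣n))

¬squarefree⇒squareful : ∀ {n} → squarefree n ≡ false → ∃[ p ] Prime p × p ℕ.* p ∣ n
¬squarefree⇒squareful {n} sq≡false
  with j , j∈[2,n] , j²∣n ← find (any⁻ _ (interval 2 n) (Equivalence.from T-≡ (not-injective sq≡false)))
  with p , pp , p∣j ← ∃-prime-divisor (proj₁ (∈-interval⁻ {b = n} j∈[2,n]))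
  = p , pp , ∣-trans (*-pres-∣ p∣j p∣j) (toWitness j²∣n)

μ-squareful : ∀ {n p} .{{_ : NonZero n}} → Prime p → p ℕ.* p ∣ n → μ n ≡ 0ℤ
μ-squareful pp p²∣n rewrite squareful⇒¬squarefree pp p²∣n = refl

squarefree-*-prime : ∀ {p e} .{{_ : NonZero e}} → Prime p → ¬ p ∣ e → squarefree (p ℕ.* e) ≡ squarefree e
squarefree-*-prime {p} {e} pp p∤e with squarefree e in sf[e] | squarefree (p ℕ.* e) in sf[pe]
... | true  | true  = refl
... | false | false = refl
... | true  | false with r , pr , r²∣pe ← ¬squarefree⇒squareful sf[pe] =
  contradiction (trans (sym sf[e]) (squareful⇒¬squarefree pr (square-∣-*-prime pp pr p∤e r²∣pe))) λ ()
... | false | true  with r , pr , r²∣e ← ¬squarefree⇒squareful sf[e] =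
  contradiction (trans (sym sf[pe]) (squareful⇒¬squarefree {{ℕ.m*n≢0 p e {{prime⇒nonZero pp}}}} pr (∣n⇒∣m*n p r²∣e))) λ ()

numPrimeDivisors-*-prime : ∀ {p e} .{{_ : NonZero e}} → Prime p → ¬ p ∣ e →
                           numPrimeDivisors (p ℕ.* e) ≡ suc (numPrimeDivisors e)
numPrimeDivisors-*-prime {p} {e} pp p∤e = ℤ.+-injective (begin
  + numPrimeDivisors (p ℕ.* e)                                        ≡⟨ as-sum (p ℕ.* e) ⟩
  ∑[ q ∈ interval 1 (p ℕ.* e) ] χ (p ℕ.* e) q                          ≡⟨ ∑-cong (interval 1 (p ℕ.* e)) split ⟩
  ∑[ q ∈ interval 1 (p ℕ.* e) ] (χ e q + 𝟙 (does (p ℕ.≟ q)))          ≡⟨ ∑-+ (χ e) _ (interval 1 (p ℕ.* e)) ⟩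
  ∑ (χ e) (interval 1 (p ℕ.* e)) + ∑[ q ∈ interval 1 (p ℕ.* e) ] 𝟙 (does (p ℕ.≟ q))
    ≡⟨ cong₂ _+_ (∑-interval-truncate (χ e) e≤pe beyond-e) (∑-interval-equal (p ℕ.* e) 1≤p) ⟩
  ∑ (χ e) (interval 1 e) + 𝟙 (does (p ℕ.≤? p ℕ.* e))                 ≡⟨ cong₂ _+_ (sym (as-sum e)) (cong 𝟙 (dec-true (p ℕ.≤? p ℕ.* e) p≤pe)) ⟩
  + numPrimeDivisors e + 1ℤ                                           ≡⟨ ℤ.+-comm (+ numPrimeDivisors e) 1ℤ ⟩
  + suc (numPrimeDivisors e)                                          ∎)
  where
  open ≡-Reasoning
  instance
    p≢0 : NonZero p
    p≢0 = prime⇒nonZero pp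
  χ : ℕ → ℕ → ℤ
  χ n q = 𝟙 (does (prime? q) ∧ does (q ∣? n))
  as-sum : ∀ n → + numPrimeDivisors n ≡ ∑ (χ n) (interval 1 n)
  as-sum n = length-filter-∑ (λ q → prime? q ×-dec (q ∣? n)) (interval 1 n)
  1≤p : 1 ≤ p
  1≤p = ℕ.>-nonZero⁻¹ p
  e≤pe : e ≤ p ℕ.* e
  e≤pe = ℕ.m≤n*m e p
  p≤pe : p ≤ p ℕ.* e
  p≤pe = ℕ.m≤m*n p e
  beyond-e : ∀ {q} → e < q → q ≤ p ℕ.* e → χ e q ≡ 0ℤ
  beyond-e {q} e<q _ with prime? q
  ... | yes _ = cong 𝟙 (dec-false (q ∣? e) (λ q∣e → ℕ.<⇒≱ e<q (∣⇒≤ q∣e)))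
  ... | no  _ = refl
  split : ∀ q → χ (p ℕ.* e) q ≡ χ e q + 𝟙 (does (p ℕ.≟ q))
  split q with prime? q | q ∣? e | q ∣? p ℕ.* e
  ... | no ¬pq | _       | _        rewrite dec-false (p ℕ.≟ q) (λ { refl → ¬pq pp }) = refl
  ... | yes _  | yes q∣e | yes _    rewrite dec-false (p ℕ.≟ q) (λ { refl → p∤e q∣e }) = refl
  ... | yes _  | yes q∣e | no q∤pe  = contradiction (∣n⇒∣m*n p q∣e) q∤pe
  ... | yes _  | no _    | no q∤pe  rewrite dec-false (p ℕ.≟ q) (λ { refl → q∤pe (m∣m*n e) }) = refl
  ... | yes pq | no q∤e  | yes q∣pe with euclidsLemma p e pq q∣pe
  ...   | inj₁ q∣p rewrite dec-true (p ℕ.≟ q) (sym (prime-∣-prime pq pp q∣p)) = refl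
  ...   | inj₂ q∣e = contradiction q∣e q∤e

μ-*-prime : ∀ {p e} .{{_ : NonZero e}} → Prime p → ¬ p ∣ e → μ (p ℕ.* e) ≡ - μ e
μ-*-prime {p} {e} pp p∤e
  rewrite squarefree-*-prime pp p∤e | numPrimeDivisors-*-prime pp p∤e with squarefree e
... | true  = ℤ.-1*i≡-i (ℤ.-1ℤ ℤ.^ numPrimeDivisors e)
... | false = refl

-- Sums over divisors

divisorSum-cong : ∀ n {f g : ℕ → ℤ} → (∀ e → suc e ∣ n → f (suc e) ≡ g (suc e)) → divisorSum n f ≡ divisorSum n g
divisorSum-cong n {f} {g} eq = ∑-cong-∈ (interval 1 n) pointwise
  where
  pointwise : ∀ {d} → d ∈ interval 1 n → (if ⌊ d ∣? n ⌋ then f d else 0ℤ) ≡ (if ⌊ d ∣? n ⌋ then g d else 0ℤ)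
  pointwise {d} d∈ with ∈-interval⁻ d∈ | d ∣? n
  ... | s≤s _ , _ | yes d∣n = eq _ d∣n
  ... | _         | no _    = refl

divisorSum-zero : ∀ n {f : ℕ → ℤ} → (∀ e → suc e ∣ n → f (suc e) ≡ 0ℤ) → divisorSum n f ≡ 0ℤ
divisorSum-zero n {f} eq = trans (divisorSum-cong n eq) (∑-zero (interval 1 n) zero-if)
  where
  zero-if : ∀ {d} → d ∈ interval 1 n → (if ⌊ d ∣? n ⌋ then 0ℤ else 0ℤ) ≡ 0ℤ
  zero-if {d} _ with ⌊ d ∣? n ⌋
  ... | true  = refl
  ... | false = refl

divisorSum-neg : ∀ n (f : ℕ → ℤ) → divisorSum n (λ d → - f d) ≡ - divisorSum n f
divisorSum-neg n f = trans (∑-cong (interval 1 n) neg-if) (∑-neg _ (interval 1 n))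
  where
  neg-if : ∀ d → (if ⌊ d ∣? n ⌋ then - f d else 0ℤ) ≡ - (if ⌊ d ∣? n ⌋ then f d else 0ℤ)
  neg-if d with ⌊ d ∣? n ⌋
  ... | true  = refl
  ... | false = refl

∑-divisorSum-comm : ∀ n (F : A → ℕ → ℤ) (xs : List A) →
                    ∑[ x ∈ xs ] divisorSum n (F x) ≡ divisorSum n (λ d → ∑[ x ∈ xs ] F x d)
∑-divisorSum-comm n F xs = trans (∑-comm _ xs (interval 1 n)) (∑-cong (interval 1 n) sum-if)
  where
  sum-if : ∀ d → ∑[ x ∈ xs ] (if ⌊ d ∣? n ⌋ then F x d else 0ℤ) ≡ (if ⌊ d ∣? n ⌋ then ∑[ x ∈ xs ] F x d else 0ℤ)
  sum-if d with ⌊ d ∣? n ⌋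
  ... | true  = refl
  ... | false = ∑-zero xs (λ _ → refl)

divisorSum-extend : ∀ {c N} .{{_ : NonZero c}} (f : ℕ → ℤ) → c ≤ N →
                    ∑[ d ∈ interval 1 N ] (if ⌊ d ∣? c ⌋ then f d else 0ℤ) ≡ divisorSum c f
divisorSum-extend {c} {N} f c≤N = ∑-interval-truncate _ c≤N vanish
  where
  vanish : ∀ {d} → c < d → d ≤ N → (if ⌊ d ∣? c ⌋ then f d else 0ℤ) ≡ 0ℤ
  vanish {d} c<d _ with d ∣? c
  ... | yes d∣c = contradiction (∣⇒≤ d∣c) (ℕ.<⇒≱ c<d)
  ... | no _    = refl

divisorSum-*-prime : ∀ {p c} .{{_ : NonZero c}} → Prime p → (f : ℕ → ℤ) →
                     divisorSum (c ℕ.* p) f ≡ divisorSum c (λ e → f (p ℕ.* e))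
                                              + divisorSum c (λ d → if does (p ∣? d) then 0ℤ else f d)
divisorSum-*-prime {p} {c} pp f = begin
  ∑ G (interval 1 (c ℕ.* p))                                              ≡⟨ ∑-cong (interval 1 (c ℕ.* p)) split ⟩
  ∑[ d ∈ interval 1 (c ℕ.* p) ] ((if does (p ∣? d) then G d else 0ℤ)
    + (if does (p ∣? d) then 0ℤ else G d))                                ≡⟨ ∑-+ _ _ (interval 1 (c ℕ.* p)) ⟩
  ∑[ d ∈ interval 1 (c ℕ.* p) ] (if does (p ∣? d) then G d else 0ℤ)
    + ∑[ d ∈ interval 1 (c ℕ.* p) ] (if does (p ∣? d) then 0ℤ else G d)   ≡⟨ cong₂ _+_ multiples-of-p other-divisors ⟩
  divisorSum c (λ e → f (p ℕ.* e)) + divisorSum c (λ d → if does (p ∣? d) then 0ℤ else f d) ∎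
  where
  open ≡-Reasoning
  instance
    p≢0 : NonZero p
    p≢0 = prime⇒nonZero pp
  G : ℕ → ℤ
  G d = if ⌊ d ∣? c ℕ.* p ⌋ then f d else 0ℤ
  split : ∀ d → G d ≡ (if does (p ∣? d) then G d else 0ℤ) + (if does (p ∣? d) then 0ℤ else G d)
  split d with does (p ∣? d)
  ... | true  = sym (ℤ.+-identityʳ (G d))
  ... | false = sym (ℤ.+-identityˡ (G d))
  pe∣cp⇔e∣c : ∀ e → G (p ℕ.* e) ≡ (if ⌊ e ∣? c ⌋ then f (p ℕ.* e) else 0ℤ)
  pe∣cp⇔e∣c e with p ℕ.* e ∣? c ℕ.* p | e ∣? c
  ... | yes _     | yes _   = refl
  ... | no _      | no _    = refl
  ... | yes pe∣cp | no e∤c  = contradiction (*-cancelˡ-∣ p (subst (p ℕ.* e ∣_) (ℕ.*-comm c p) pe∣cp)) e∤c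
  ... | no pe∤cp  | yes e∣c = contradiction (subst (p ℕ.* e ∣_) (ℕ.*-comm p c) (*-monoʳ-∣ p e∣c)) pe∤cp
  multiples-of-p : ∑[ d ∈ interval 1 (c ℕ.* p) ] (if does (p ∣? d) then G d else 0ℤ) ≡ divisorSum c (λ e → f (p ℕ.* e))
  multiples-of-p = trans (∑-multiples p G c) (∑-cong (interval 1 c) pe∣cp⇔e∣c)
  coprime-to-p : ∀ d → (if does (p ∣? d) then 0ℤ else G d)
                       ≡ (if ⌊ d ∣? c ⌋ then (if does (p ∣? d) then 0ℤ else f d) else 0ℤ)
  coprime-to-p d with p ∣? d | d ∣? c | d ∣? c ℕ.* p
  ... | yes _   | yes _   | _        = refl
  ... | yes _   | no _    | _        = refl
  ... | no _    | yes _   | yes _    = refl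
  ... | no _    | no _    | no _     = refl
  ... | no _    | yes d∣c | no d∤cp  = contradiction (∣m⇒∣m*n p d∣c) d∤cp
  ... | no p∤d  | no d∤c  | yes d∣cp =
    contradiction (coprime-divisor (Coprime.sym (prime-∤⇒coprime pp p∤d)) (subst (d ∣_) (ℕ.*-comm c p) d∣cp)) d∤c
  other-divisors : ∑[ d ∈ interval 1 (c ℕ.* p) ] (if does (p ∣? d) then 0ℤ else G d)
                   ≡ divisorSum c (λ d → if does (p ∣? d) then 0ℤ else f d)
  other-divisors = trans (∑-cong (interval 1 (c ℕ.* p)) coprime-to-p) (divisorSum-extend _ (ℕ.m≤m*n c p))

divisorSum-μ : ∀ n .{{_ : NonZero n}} → divisorSum n μ ≡ 𝟙 (does (n ℕ.≟ 1))
divisorSum-μ 1                  = refl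
divisorSum-μ n@(suc (suc _)) with p , pp , divides c n≡cp ← ∃-prime-divisor {n} (s≤s (s≤s z≤n)) = begin
  divisorSum n μ                                                    ≡⟨ cong (λ m → divisorSum m μ) n≡cp ⟩
  divisorSum (c ℕ.* p) μ                                            ≡⟨ divisorSum-*-prime pp μ ⟩
  divisorSum c (λ e → μ (p ℕ.* e)) + divisorSum c μ∤p               ≡⟨ cong (_+ divisorSum c μ∤p) (divisorSum-cong c (λ e _ → μ[p*e]≡-μ∤p[e] e)) ⟩
  divisorSum c (λ e → - μ∤p e) + divisorSum c μ∤p                   ≡⟨ cong (_+ divisorSum c μ∤p) (divisorSum-neg c μ∤p) ⟩
  - divisorSum c μ∤p + divisorSum c μ∤p                             ≡⟨ ℤ.+-inverseˡ (divisorSum c μ∤p) ⟩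
  0ℤ                                                                ∎
  where
  open ≡-Reasoning
  instance
    c≢0 : NonZero c
    c≢0 = ℕ.m*n≢0⇒m≢0 c {{subst NonZero n≡cp it}}
  μ∤p : ℕ → ℤ
  μ∤p d = if does (p ∣? d) then 0ℤ else μ d
  μ[p*e]≡-μ∤p[e] : ∀ e → μ (p ℕ.* suc e) ≡ - μ∤p (suc e)
  μ[p*e]≡-μ∤p[e] e with p ∣? suc e
  ... | yes p∣e = μ-squareful {{ℕ.m*n≢0 p (suc e) {{prime⇒nonZero pp}}}} pp (*-monoʳ-∣ p p∣e)
  ... | no  p∤e = μ-*-prime pp p∤e

all-∣⇔∣gcdList : ∀ d X → all (λ x → does (d ∣? x)) X ≡ does (d ∣? gcdList X)
all-∣⇔∣gcdList d []      = sym (dec-true (d ∣? 0) (d ∣0))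
all-∣⇔∣gcdList d (x ∷ X) rewrite all-∣⇔∣gcdList d X with d ∣? x | d ∣? gcdList X
... | yes d∣x | yes d∣g = sym (dec-true (d ∣? gcd x (gcdList X)) (gcd-greatest d∣x d∣g))
... | yes _   | no d∤g  = sym (dec-false (d ∣? gcd x (gcdList X)) (λ d∣gcd → d∤g (∣-trans d∣gcd (gcd[m,n]∣n x _))))
... | no d∤x  | _       = sym (dec-false (d ∣? gcd x (gcdList X)) (λ d∣gcd → d∤x (∣-trans d∣gcd (gcd[m,n]∣m x _))))

∣⇒nonZero : ∀ {m n} .{{_ : NonZero n}} → m ∣ n → NonZero m
∣⇒nonZero {n = n} (divides q n≡qm) = ℕ.m*n≢0⇒n≢0 q {{subst NonZero n≡qm it}}

gcdList-∣ : ∀ {a X} → a ∈ X → gcdList X ∣ a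
gcdList-∣ {X = x ∷ X} (here refl) = gcd[m,n]∣m x (gcdList X)
gcdList-∣ {X = x ∷ X} (there a∈X) = ∣-trans (gcd[m,n]∣n x (gcdList X)) (gcdList-∣ a∈X)

𝟙-gcdList≡1 : ∀ {n X} .{{_ : NonZero n}} → n ∈ X →
              𝟙 (does (gcdList X ℕ.≟ 1)) ≡ divisorSum n (λ d → μ d * 𝟙 (all (λ x → does (d ∣? x)) X))
𝟙-gcdList≡1 {n} {X} n∈X = begin
  𝟙 (does (c ℕ.≟ 1))                                         ≡⟨ divisorSum-μ c ⟨
  divisorSum c μ                                             ≡⟨ divisorSum-extend μ (∣⇒≤ c∣n) ⟨
  ∑[ d ∈ interval 1 n ] (if ⌊ d ∣? c ⌋ then μ d else 0ℤ)    ≡⟨ ∑-cong (interval 1 n) pointwise ⟩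
  divisorSum n (λ d → μ d * 𝟙 (all (λ x → does (d ∣? x)) X)) ∎
  where
  open ≡-Reasoning
  c : ℕ
  c = gcdList X
  c∣n : c ∣ n
  c∣n = gcdList-∣ n∈X
  instance
    c≢0 : NonZero c
    c≢0 = ∣⇒nonZero c∣n
  pointwise : ∀ d → (if ⌊ d ∣? c ⌋ then μ d else 0ℤ) ≡ (if ⌊ d ∣? n ⌋ then μ d * 𝟙 (all (λ x → does (d ∣? x)) X) else 0ℤ)
  pointwise d rewrite all-∣⇔∣gcdList d X with d ∣? c | d ∣? n
  ... | yes _   | yes _   = sym (ℤ.*-identityʳ (μ d))
  ... | yes d∣c | no d∤n  = contradiction (∣-trans d∣c c∣n) d∤n
  ... | no _    | yes _   = sym (ℤ.*-zeroʳ (μ d))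
  ... | no _    | no _    = refl

𝟙-∈∧gcdList≡1 : ∀ {n X} .{{_ : NonZero n}} (n∈? : Dec (n ∈ X)) (r : Bool) →
                𝟙 (does n∈? ∧ (r ∧ does (gcdList X ℕ.≟ 1)))
                ≡ divisorSum n (λ d → μ d * 𝟙 (does n∈? ∧ (r ∧ all (λ x → does (d ∣? x)) X)))
𝟙-∈∧gcdList≡1     (yes n∈X) true  = 𝟙-gcdList≡1 n∈X
𝟙-∈∧gcdList≡1 {n} (yes _)   false = sym (divisorSum-zero n (λ e _ → ℤ.*-zeroʳ (μ (suc e))))
𝟙-∈∧gcdList≡1 {n} (no _)    r     = sym (divisorSum-zero n (λ e _ → ℤ.*-zeroʳ (μ (suc e))))

sieve : ∀ n .{{_ : NonZero n}} (R : List ℕ → Bool) (Xs : List (List ℕ)) →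
        ∑[ X ∈ Xs ] 𝟙 (does (n ∈? X) ∧ (R X ∧ does (gcdList X ℕ.≟ 1)))
        ≡ divisorSum n (λ d → μ d * ∑[ X ∈ Xs ] 𝟙 (does (n ∈? X) ∧ (R X ∧ all (λ x → does (d ∣? x)) X)))
sieve n R Xs = begin
  ∑[ X ∈ Xs ] 𝟙 (does (n ∈? X) ∧ (R X ∧ does (gcdList X ℕ.≟ 1)))   ≡⟨ ∑-cong Xs (λ X → 𝟙-∈∧gcdList≡1 (n ∈? X) (R X)) ⟩
  ∑[ X ∈ Xs ] divisorSum n (λ d → μ d * χ d X)                       ≡⟨ ∑-divisorSum-comm n (λ X d → μ d * χ d X) Xs ⟩
  divisorSum n (λ d → ∑[ X ∈ Xs ] (μ d * χ d X))                     ≡⟨ divisorSum-cong n (λ e _ → ∑-*ˡ (μ (suc e)) (χ (suc e)) Xs) ⟩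
  divisorSum n (λ d → μ d * ∑ (χ d) Xs)                              ∎
  where
  open ≡-Reasoning
  χ : ℕ → List ℕ → ℤ
  χ d X = 𝟙 (does (n ∈? X) ∧ (R X ∧ all (λ x → does (d ∣? x)) X))

-- Counting sublists

count : (A → Bool) → List A → ℕ
count P []       = 0
count P (x ∷ xs) = if P x then suc (count P xs) else count P xs

count-∑ : (P : A → Bool) (xs : List A) → + count P xs ≡ ∑[ x ∈ xs ] 𝟙 (P x)
count-∑ P []       = refl
count-∑ P (x ∷ xs) with P x
... | true  = cong (_+_ 1ℤ) (count-∑ P xs)
... | false = trans (count-∑ P xs) (sym (ℤ.+-identityˡ _))

∑-sublists-∷ : (f : List ℕ → ℤ) (x : ℕ) (xs : List ℕ) →
               ∑ f (sublists (x ∷ xs)) ≡ ∑[ X ∈ sublists xs ] f (x ∷ X) + ∑ f (sublists xs)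
∑-sublists-∷ f x xs =
  trans (∑-++ f (map (x ∷_) (sublists xs)) (sublists xs)) (cong (_+ ∑ f (sublists xs)) (∑-map f (x ∷_) (sublists xs)))

∑-sublists-all : (P : ℕ → Bool) (xs : List ℕ) → ∑[ X ∈ sublists xs ] 𝟙 (all P X) ≡ + (2 ^ count P xs)
∑-sublists-all P []       = refl
∑-sublists-all P (x ∷ xs) with P x in Px
... | true  = begin
  ∑[ X ∈ sublists (x ∷ xs) ] 𝟙 (all P X)                                 ≡⟨ ∑-sublists-∷ (𝟙 ∘ all P) x xs ⟩
  ∑[ X ∈ sublists xs ] 𝟙 (P x ∧ all P X) + ∑[ X ∈ sublists xs ] 𝟙 (all P X)
    ≡⟨ cong (_+ ∑[ X ∈ sublists xs ] 𝟙 (all P X)) (∑-cong (sublists xs) (λ X → cong (λ b → 𝟙 (b ∧ all P X)) Px)) ⟩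
  ∑[ X ∈ sublists xs ] 𝟙 (all P X) + ∑[ X ∈ sublists xs ] 𝟙 (all P X)    ≡⟨ cong₂ _+_ (∑-sublists-all P xs) (∑-sublists-all P xs) ⟩
  + (2 ^ count P xs) + + (2 ^ count P xs)                                ≡⟨ cong (λ m → + (2 ^ count P xs ℕ.+ m)) (ℕ.+-identityʳ (2 ^ count P xs)) ⟨
  + (2 ^ suc (count P xs))                                               ∎
  where open ≡-Reasoning
... | false = begin
  ∑[ X ∈ sublists (x ∷ xs) ] 𝟙 (all P X)                                 ≡⟨ ∑-sublists-∷ (𝟙 ∘ all P) x xs ⟩
  ∑[ X ∈ sublists xs ] 𝟙 (P x ∧ all P X) + ∑[ X ∈ sublists xs ] 𝟙 (all P X)
    ≡⟨ cong₂ _+_ (∑-zero (sublists xs) (λ {X} _ → cong (λ b → 𝟙 (b ∧ all P X)) Px)) (∑-sublists-all P xs) ⟩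
  0ℤ + + (2 ^ count P xs)                                                ≡⟨ ℤ.+-identityˡ _ ⟩
  + (2 ^ count P xs)                                                     ∎
  where open ≡-Reasoning

∑-sublists-length-all : (P : ℕ → Bool) (xs : List ℕ) (k : ℕ) →
                        ∑[ X ∈ sublists xs ] 𝟙 (does (length X ℕ.≟ k) ∧ all P X) ≡ + (count P xs C k)
∑-sublists-length-all P []       zero    = refl
∑-sublists-length-all P []       (suc k) = refl
∑-sublists-length-all P (x ∷ xs) k       with P x in Px
∑-sublists-length-all P (x ∷ xs) zero    | true  = begin
  ∑ (χ zero) (sublists (x ∷ xs))                                  ≡⟨ ∑-sublists-∷ (χ zero) x xs ⟩
  ∑[ X ∈ sublists xs ] χ zero (x ∷ X) + ∑ (χ zero) (sublists xs)  ≡⟨ cong₂ _+_ (∑-zero (sublists xs) (λ _ → refl)) (∑-sublists-length-all P xs zero) ⟩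
  0ℤ + + (count P xs C zero)                                      ≡⟨ ℤ.+-identityˡ _ ⟩
  + (suc (count P xs) C zero)                                     ∎
  where
  open ≡-Reasoning
  χ : ℕ → List ℕ → ℤ
  χ k X = 𝟙 (does (length X ℕ.≟ k) ∧ all P X)
∑-sublists-length-all P (x ∷ xs) (suc k) | true  = begin
  ∑ (χ (suc k)) (sublists (x ∷ xs))                                 ≡⟨ ∑-sublists-∷ (χ (suc k)) x xs ⟩
  ∑[ X ∈ sublists xs ] χ (suc k) (x ∷ X) + ∑ (χ (suc k)) (sublists xs)
    ≡⟨ cong (_+ ∑ (χ (suc k)) (sublists xs)) (∑-cong (sublists xs) (λ X → cong (λ b → 𝟙 (does (length X ℕ.≟ k) ∧ (b ∧ all P X))) Px)) ⟩
  ∑ (χ k) (sublists xs) + ∑ (χ (suc k)) (sublists xs)               ≡⟨ cong₂ _+_ (∑-sublists-length-all P xs k) (∑-sublists-length-all P xs (suc k)) ⟩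
  + (count P xs C k) + + (count P xs C suc k)                       ≡⟨ cong +_ (nCk+nC[k+1]≡[n+1]C[k+1] (count P xs) k) ⟩
  + (suc (count P xs) C suc k)                                      ∎
  where
  open ≡-Reasoning
  χ : ℕ → List ℕ → ℤ
  χ k X = 𝟙 (does (length X ℕ.≟ k) ∧ all P X)
∑-sublists-length-all P (x ∷ xs) k       | false = begin
  ∑ χ (sublists (x ∷ xs))                              ≡⟨ ∑-sublists-∷ χ x xs ⟩
  ∑[ X ∈ sublists xs ] χ (x ∷ X) + ∑ χ (sublists xs)   ≡⟨ cong₂ _+_ (∑-zero (sublists xs) excluded) (∑-sublists-length-all P xs k) ⟩
  0ℤ + + (count P xs C k)                              ≡⟨ ℤ.+-identityˡ _ ⟩
  + (count P xs C k)                                   ∎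
  where
  open ≡-Reasoning
  χ : List ℕ → ℤ
  χ X = 𝟙 (does (length X ℕ.≟ k) ∧ all P X)
  excluded : ∀ {X} → X ∈ sublists xs → χ (x ∷ X) ≡ 0ℤ
  excluded {X} _ = cong 𝟙 (trans (cong (λ b → does (suc (length X) ℕ.≟ k) ∧ (b ∧ all P X)) Px) (∧-zeroʳ _))

dec-true⁻¹ : ∀ {P : Set} (P? : Dec P) → does P? ≡ true → P
dec-true⁻¹ (yes p) _ = p

∈?≡any : ∀ a X → does (a ∈? X) ≡ any (λ x → does (a ℕ.≟ x)) X
∈?≡any a []      = refl
∈?≡any a (x ∷ X) = cong (does (a ℕ.≟ x) ∨_) (∈?≡any a X)

all-∧-not : (P Q : A → Bool) (X : List A) → all (λ x → P x ∧ not (Q x)) X ≡ all P X ∧ not (any Q X)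
all-∧-not P Q []      = refl
all-∧-not P Q (x ∷ X) rewrite all-∧-not P Q X with P x | Q x
... | true  | true  = sym (∧-zeroʳ (all P X))
... | true  | false = refl
... | false | _     = refl

𝟙-∧-split : ∀ m r p → 𝟙 (m ∧ (r ∧ p)) ≡ 𝟙 (r ∧ p) - 𝟙 (r ∧ (p ∧ not m))
𝟙-∧-split true  true  true  = refl
𝟙-∧-split true  true  false = refl
𝟙-∧-split true  false _     = refl
𝟙-∧-split false true  true  = refl
𝟙-∧-split false true  false = refl
𝟙-∧-split false false _     = refl

count-∧-not : (P Q : A → Bool) (xs : List A) → (∀ x → Q x ≡ true → P x ≡ true) →
              + count (λ x → P x ∧ not (Q x)) xs ≡ + count P xs - + count Q xs
count-∧-not P Q xs Q⇒P = begin
  + count (λ x → P x ∧ not (Q x)) xs           ≡⟨ count-∑ _ xs ⟩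
  ∑[ x ∈ xs ] 𝟙 (P x ∧ not (Q x))              ≡⟨ ∑-cong xs pointwise ⟩
  ∑[ x ∈ xs ] (𝟙 (P x) - 𝟙 (Q x))              ≡⟨ ∑-- (𝟙 ∘ P) (𝟙 ∘ Q) xs ⟩
  ∑[ x ∈ xs ] 𝟙 (P x) - ∑[ x ∈ xs ] 𝟙 (Q x)    ≡⟨ cong₂ _-_ (count-∑ P xs) (count-∑ Q xs) ⟨
  + count P xs - + count Q xs                  ∎
  where
  open ≡-Reasoning
  pointwise : ∀ x → 𝟙 (P x ∧ not (Q x)) ≡ 𝟙 (P x) - 𝟙 (Q x)
  pointwise x with P x in Px | Q x in Qx
  ... | true  | true  = refl
  ... | true  | false = refl
  ... | false | false = refl
  ... | false | true  = contradiction (trans (sym Px) (Q⇒P x Qx)) λ ()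

∑-∈-complement : ∀ a (R : List ℕ → Bool) (P : ℕ → Bool) (Xs : List (List ℕ)) →
                 ∑[ X ∈ Xs ] 𝟙 (does (a ∈? X) ∧ (R X ∧ all P X))
                 ≡ ∑[ X ∈ Xs ] 𝟙 (R X ∧ all P X) - ∑[ X ∈ Xs ] 𝟙 (R X ∧ all (λ x → P x ∧ not (does (a ℕ.≟ x))) X)
∑-∈-complement a R P Xs = trans (∑-cong Xs pointwise) (∑-- _ _ Xs)
  where
  pointwise : ∀ X → 𝟙 (does (a ∈? X) ∧ (R X ∧ all P X))
                    ≡ 𝟙 (R X ∧ all P X) - 𝟙 (R X ∧ all (λ x → P x ∧ not (does (a ℕ.≟ x))) X)
  pointwise X rewrite all-∧-not P (λ x → does (a ℕ.≟ x)) X | sym (∈?≡any a X) = 𝟙-∧-split (does (a ∈? X)) (R X) (all P X)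

count-without : ∀ {a} (P : ℕ → Bool) (xs : List ℕ) → P a ≡ true → count (λ x → does (a ℕ.≟ x)) xs ≡ 1 →
                count P xs ≡ suc (count (λ x → P x ∧ not (does (a ℕ.≟ x))) xs)
count-without {a} P xs Pa a-once = ℤ.+-injective (begin
  + count P xs                                  ≡⟨ i≡i-1+1 (+ count P xs) ⟩
  + count P xs - 1ℤ + 1ℤ                        ≡⟨ cong (λ n → + count P xs - + n + 1ℤ) a-once ⟨
  + count P xs - + count Q xs + 1ℤ              ≡⟨ cong (_+ 1ℤ) (count-∧-not P Q xs Q⇒P) ⟨
  + count (λ x → P x ∧ not (Q x)) xs + 1ℤ       ≡⟨ ℤ.+-comm (+ count (λ x → P x ∧ not (Q x)) xs) 1ℤ ⟩
  + suc (count (λ x → P x ∧ not (Q x)) xs)      ∎)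
  where
  open ≡-Reasoning
  Q : ℕ → Bool
  Q x = does (a ℕ.≟ x)
  Q⇒P : ∀ x → Q x ≡ true → P x ≡ true
  Q⇒P x Qx with refl ← dec-true⁻¹ (a ℕ.≟ x) Qx = Pa
  i≡i-1+1 : ∀ i → i ≡ i - 1ℤ + 1ℤ
  i≡i-1+1 = solve-∀

module Sublists-∋ {a c : ℕ} (P : ℕ → Bool) (xs : List ℕ) (Pa : P a ≡ true)
         (a-once : count (λ x → does (a ℕ.≟ x)) xs ≡ 1) (count≡1+c : count P xs ≡ suc c) where

  private
    i+j-j≡i : ∀ i j → i + j - j ≡ i
    i+j-j≡i = solve-∀

    P′ : ℕ → Bool
    P′ x = P x ∧ not (does (a ℕ.≟ x))

    count′≡c : count P′ xs ≡ c
    count′≡c = ℕ.suc-injective (trans (sym (count-without P xs Pa a-once)) count≡1+c)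

  ∑-sublists-∋-all : ∑[ X ∈ sublists xs ] 𝟙 (does (a ∈? X) ∧ all P X) ≡ + (2 ^ c)
  ∑-sublists-∋-all = begin
    ∑[ X ∈ sublists xs ] 𝟙 (does (a ∈? X) ∧ all P X)                         ≡⟨ ∑-∈-complement a (λ _ → true) P (sublists xs) ⟩
    ∑[ X ∈ sublists xs ] 𝟙 (all P X) - ∑[ X ∈ sublists xs ] 𝟙 (all P′ X)    ≡⟨ cong₂ _-_ (∑-sublists-all P xs) (∑-sublists-all P′ xs) ⟩
    + (2 ^ count P xs) - + (2 ^ count P′ xs)                                 ≡⟨ cong₂ (λ m n → + (2 ^ m) - + (2 ^ n)) count≡1+c count′≡c ⟩
    + (2 ^ suc c) - + (2 ^ c)                                                ≡⟨ cong (λ m → + (2 ^ c ℕ.+ m) - + (2 ^ c)) (ℕ.+-identityʳ (2 ^ c)) ⟩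
    + (2 ^ c) + + (2 ^ c) - + (2 ^ c)                                        ≡⟨ i+j-j≡i (+ (2 ^ c)) (+ (2 ^ c)) ⟩
    + (2 ^ c)                                                                ∎
    where open ≡-Reasoning

  ∑-sublists-∋-length-all : ∀ k → ∑[ X ∈ sublists xs ] 𝟙 (does (a ∈? X) ∧ (does (length X ℕ.≟ suc k) ∧ all P X))
                                  ≡ + (c C k)
  ∑-sublists-∋-length-all k = begin
    ∑[ X ∈ sublists xs ] 𝟙 (does (a ∈? X) ∧ (does (length X ℕ.≟ suc k) ∧ all P X))
      ≡⟨ ∑-∈-complement a (λ X → does (length X ℕ.≟ suc k)) P (sublists xs) ⟩
    ∑[ X ∈ sublists xs ] 𝟙 (does (length X ℕ.≟ suc k) ∧ all P X)
      - ∑[ X ∈ sublists xs ] 𝟙 (does (length X ℕ.≟ suc k) ∧ all P′ X)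
      ≡⟨ cong₂ _-_ (∑-sublists-length-all P xs (suc k)) (∑-sublists-length-all P′ xs (suc k)) ⟩
    + (count P xs C suc k) - + (count P′ xs C suc k)   ≡⟨ cong₂ (λ m n → + (m C suc k) - + (n C suc k)) count≡1+c count′≡c ⟩
    + (suc c C suc k) - + (c C suc k)                  ≡⟨ cong (λ m → + m - + (c C suc k)) (nCk+nC[k+1]≡[n+1]C[k+1] c k) ⟨
    + (c C k) + + (c C suc k) - + (c C suc k)          ≡⟨ i+j-j≡i (+ (c C k)) (+ (c C suc k)) ⟩
    + (c C k)                                          ∎
    where open ≡-Reasoning

-- The ground set

∑-ground : ∀ (f : ℕ → ℤ) m1 {a m2} → a ≤ m2 →
           ∑ f (ground m1 (suc a) m2) ≡ ∑ f (interval 1 m1) + (∑ f (interval 1 m2) - ∑ f (interval 1 a))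
∑-ground f m1 {a} {m2} a≤m2 = trans (∑-++ f (interval 1 m1) (interval (suc a) m2)) (cong (_+_ (∑ f (interval 1 m1))) upper)
  where
  upper : ∑ f (interval (suc a) m2) ≡ ∑ f (interval 1 m2) - ∑ f (interval 1 a)
  upper = trans (sym (j+i-j≡i (∑ f (interval 1 a)) _)) (cong (_- ∑ f (interval 1 a)) (sym (∑-interval-++ f a≤m2)))
    where j+i-j≡i : ∀ j i → j + i - j ≡ i
          j+i-j≡i = solve-∀

count-ground-equal : ∀ {m1 a m2} → m1 ≤ a → suc a ≤ m2 → count (λ x → does (suc a ℕ.≟ x)) (ground m1 (suc a) m2) ≡ 1
count-ground-equal {m1} {a} {m2} m1≤a l2≤m2 = ℤ.+-injective (begin
  + count χ (ground m1 (suc a) m2)                                   ≡⟨ count-∑ χ (ground m1 (suc a) m2) ⟩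
  ∑[ x ∈ ground m1 (suc a) m2 ] 𝟙 (χ x)                              ≡⟨ ∑-ground (𝟙 ∘ χ) m1 (ℕ.≤-trans (ℕ.n≤1+n a) l2≤m2) ⟩
  ∑ (𝟙 ∘ χ) (interval 1 m1) + (∑ (𝟙 ∘ χ) (interval 1 m2) - ∑ (𝟙 ∘ χ) (interval 1 a))
    ≡⟨ cong₂ (λ u v → u + (v - ∑ (𝟙 ∘ χ) (interval 1 a))) (∑-interval-equal m1 (s≤s z≤n)) (∑-interval-equal m2 (s≤s z≤n)) ⟩
  𝟙 (does (suc a ℕ.≤? m1)) + (𝟙 (does (suc a ℕ.≤? m2)) - ∑ (𝟙 ∘ χ) (interval 1 a))
    ≡⟨ cong (λ v → 𝟙 (does (suc a ℕ.≤? m1)) + (𝟙 (does (suc a ℕ.≤? m2)) - v)) (∑-interval-equal a (s≤s z≤n)) ⟩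
  𝟙 (does (suc a ℕ.≤? m1)) + (𝟙 (does (suc a ℕ.≤? m2)) - 𝟙 (does (suc a ℕ.≤? a)))
    ≡⟨ cong₂ (λ u v → 𝟙 u + (𝟙 v - 𝟙 (does (suc a ℕ.≤? a)))) (dec-false (suc a ℕ.≤? m1) (ℕ.<⇒≱ (s≤s m1≤a))) (dec-true (suc a ℕ.≤? m2) l2≤m2) ⟩
  0ℤ + (1ℤ - 𝟙 (does (suc a ℕ.≤? a)))                               ≡⟨ cong (λ u → 0ℤ + (1ℤ - 𝟙 u)) (dec-false (suc a ℕ.≤? a) ℕ.1+n≰n) ⟩
  1ℤ                                                                 ∎)
  where
  open ≡-Reasoning
  χ : ℕ → Bool
  χ x = does (suc a ℕ.≟ x)

count-ground-divisible : ∀ {m1 a m2 e} → suc a ≤ m2 → suc e ∣ suc a →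
                         count (λ x → does (suc e ∣? x)) (ground m1 (suc a) m2) ≡ suc (expo m1 (suc a) m2 (suc e))
count-ground-divisible {m1} {a} {m2} {e} l2≤m2 d∣l2 = ℤ.+-injective (begin
  + count χ (ground m1 (suc a) m2)                                       ≡⟨ count-∑ χ (ground m1 (suc a) m2) ⟩
  ∑[ x ∈ ground m1 (suc a) m2 ] 𝟙 (χ x)                                  ≡⟨ ∑-ground (𝟙 ∘ χ) m1 (ℕ.≤-trans (ℕ.n≤1+n a) l2≤m2) ⟩
  ∑ (𝟙 ∘ χ) (interval 1 m1) + (∑ (𝟙 ∘ χ) (interval 1 m2) - ∑ (𝟙 ∘ χ) (interval 1 a))
    ≡⟨ cong₂ _+_ (∑-interval-divisible d m1) (cong₂ _-_ (∑-interval-divisible d m2) (∑-interval-divisible d a)) ⟩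
  + (m1 / d) + (+ (m2 / d) - + (a / d))                                   ≡⟨ rearrange (+ (m1 / d)) (+ (m2 / d)) (+ (a / d)) ⟩
  1ℤ + (+ (m1 / d) + + (m2 / d) - (+ (a / d) + 1ℤ))                      ≡⟨ cong₂ (λ u v → 1ℤ + (u - v)) (ℤ.pos-+ (m1 / d) (m2 / d)) l2/d ⟨
  1ℤ + (+ (m1 / d ℕ.+ m2 / d) - + (suc a / d))                            ≡⟨ cong (_+_ 1ℤ) (ℤ.m-n≡m⊖n (m1 / d ℕ.+ m2 / d) (suc a / d)) ⟩
  1ℤ + (m1 / d ℕ.+ m2 / d ℤ.⊖ suc a / d)                                  ≡⟨ cong (_+_ 1ℤ) (ℤ.⊖-≥ l2/d≤m1/d+m2/d) ⟩
  + suc (expo m1 (suc a) m2 d)                                          ∎)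
  where
  open ≡-Reasoning
  d = suc e
  χ : ℕ → Bool
  χ x = does (d ∣? x)
  l2/d : + (suc a / d) ≡ + (a / d) + 1ℤ
  l2/d = begin
    + (suc a / d)                            ≡⟨ ∑-interval-divisible d (suc a) ⟨
    ∑ (𝟙 ∘ χ) (interval 1 (suc a))           ≡⟨ ∑-interval-∷ʳ (𝟙 ∘ χ) a ⟩
    ∑ (𝟙 ∘ χ) (interval 1 a) + 𝟙 (χ (suc a)) ≡⟨ cong₂ _+_ (∑-interval-divisible d a) (cong 𝟙 (dec-true (d ∣? suc a) d∣l2)) ⟩
    + (a / d) + 1ℤ                           ∎
  l2/d≤m1/d+m2/d : suc a / d ≤ m1 / d ℕ.+ m2 / d
  l2/d≤m1/d+m2/d = ℕ.≤-trans (/-monoˡ-≤ d l2≤m2) (ℕ.m≤n+m (m2 / d) (m1 / d))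
  rearrange : ∀ i j k → i + (j - k) ≡ 1ℤ + (i + j - (k + 1ℤ))
  rearrange = solve-∀

lemma1 : (m1 l2 m2 k : ℕ) → 1 ≤ m1 → m1 < l2 → l2 ≤ m2 → 1 ≤ k →
    ((+ g m1 l2 m2) ≡ rhsA m1 l2 m2) × ((+ gk k m1 l2 m2) ≡ rhsB k m1 l2 m2)
lemma1 m1 l2@(suc a) m2 (suc k) _ (s≤s m1≤a) l2≤m2 _ = part-a , part-b
  where
  open ≡-Reasoning
  G : List ℕ
  G = ground m1 l2 m2
  divisible-by : ℕ → ℕ → Bool
  divisible-by d x = does (d ∣? x)
  module Count {e} (d∣l2 : suc e ∣ l2) = Sublists-∋ {l2} {expo m1 l2 m2 (suc e)} (divisible-by (suc e)) G
    (dec-true (suc e ∣? l2) d∣l2) (count-ground-equal m1≤a l2≤m2) (count-ground-divisible {m1} l2≤m2 d∣l2)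
  part-a : + g m1 l2 m2 ≡ rhsA m1 l2 m2
  part-a = begin
    + g m1 l2 m2                                                              ≡⟨ length-filter-∑ _ (sublists G) ⟩
    ∑[ X ∈ sublists G ] 𝟙 (does (l2 ∈? X) ∧ (true ∧ does (gcdList X ℕ.≟ 1))) ≡⟨ sieve l2 (λ _ → true) (sublists G) ⟩
    divisorSum l2 (λ d → μ d * ∑[ X ∈ sublists G ] 𝟙 (does (l2 ∈? X) ∧ all (divisible-by d) X))
      ≡⟨ divisorSum-cong l2 (λ e d∣l2 → cong (μ (suc e) *_) (Count.∑-sublists-∋-all d∣l2)) ⟩
    rhsA m1 l2 m2                                                             ∎
  part-b : + gk (suc k) m1 l2 m2 ≡ rhsB (suc k) m1 l2 m2
  part-b = begin
    + gk (suc k) m1 l2 m2                                                     ≡⟨ length-filter-∑ _ (sublists G) ⟩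
    ∑[ X ∈ sublists G ] 𝟙 (does (l2 ∈? X) ∧ (does (length X ℕ.≟ suc k) ∧ does (gcdList X ℕ.≟ 1)))
      ≡⟨ sieve l2 (λ X → does (length X ℕ.≟ suc k)) (sublists G) ⟩
    divisorSum l2 (λ d → μ d * ∑[ X ∈ sublists G ] 𝟙 (does (l2 ∈? X) ∧ (does (length X ℕ.≟ suc k) ∧ all (divisible-by d) X)))
      ≡⟨ divisorSum-cong l2 (λ e d∣l2 → cong (μ (suc e) *_) (Count.∑-sublists-∋-length-all d∣l2 k)) ⟩
    rhsB (suc k) m1 l2 m2                                                     ∎
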